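{- Let $a<A<\omega$, let $\mathcal{F}$ be a class of $A$-frames, let $(\varphi,\mathbf{v},\mathbf{U})$ be an $A$-tie, and let $0<h,b<\omega$. Then $(\varphi,\mathbf{v},\mathbf{U})$ is satisfiable in $\Sigma^a_{\mathrm{Tr}(h,b)}\mathcal{F}$ if and only if the procedure $\mathrm{CSatSum}_{\mathcal{F}}(\varphi,\mathbf{v},\mathbf{U},h,b)$ (described in the context, using an oracle for conditional satisfiability in $\mathcal{F}$) returns true.
   Context: For $A<\omega$, $A$-formulas are built from variables with $\bot,\to$ and modalities $\Diamond_c$, $c<A$. An $A$-frame is $(W,(R_c)_{c<A})$, $W\ne\emptyset$; models are standard Kripke models. Conditional truth: a condition is a sequence $\Gamma=(\Gamma_c)_{c<A}$ of sets of formulas. For a model $M=(W,(R_c),\theta)$ and $w\in W$ define $M,w\models^{\Gamma}\psi$ by induction: $\bot$ is never true, variables as usual, $\to$ classically, and $M,w\models^{\Gamma}\Diamond_c\psi$ iff $\psi\in\Gamma_c$ or $M,v\models^\Gamma\psi$ for some $v$ with $wR_cv$. Let $\#\varphi$ be the number of subformulas of $\varphi$ and $\psi_0=\varphi,\psi_1,\dots,\psi_{\#\varphi-1}$ the list of its subformulas in a fixed polynomial-time computable order. A tie is a triple $(\varphi,\mathbf{v},\mathbf{U})$ with $\mathbf{v}\in 2^{\#\varphi}$ and $\mathbf{U}=(\mathbf{u}_c)_{c<A}$, $\mathbf{u}_c\in 2^{\#\varphi}$; it is satisfiable in a class $\mathcal{C}$ of $A$-frames if there is a model $M$ on a frame of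 $\mathcal{C}$ such that, with $\Gamma_c=\{\psi_i:\mathbf{u}_c(i)=1\}$, we have $\{\psi_i:\mathbf{v}(i)=1\}=\{\psi_i: M,w\models^{\Gamma}\psi_i\text{ for some }w\}$. For Boolean vectors, $\mathbf{v}+\mathbf{u}$ is componentwise disjunction; $\mathbf{U}\oplus_a\mathbf{w}$ is $\mathbf{U}$ with its $a$-th component $\mathbf{u}_a$ replaced by $\mathbf{u}_a+\mathbf{w}$. $a$-sums: for a unimodal frame $(I,S)$ and $A$-frames $\mathbf{F}_i=(W_i,(R_{i,c}))$, $\Sigma^a_{(I,S)}\mathbf{F}_i$ has domain $\{(i,w):i\in I,w\in W_i\}$, and $(i,w)R_c(j,v)$ iff ($i=j$ and $wR_{i,c}v$) or ($i\ne j$, $c=a$ and $iSj$). $\Sigma^a_{\mathcal{I}}\mathcal{F}$ is the class of all such sums with $(I,S)\in\mathcal{I}$ and all $\mathbf{F}_i\in\mathcal{F}$. A finite tree is a finite strict partial order with a least element in which the predecessors of each element form a chain; its height is the maximal size of a chain, its branching the maximal number of immediate successors of an element. $\mathrm{Tr}(h,b)$ is the class of finite trees of height $\le h$ and branching $\le b$. Procedure $\mathrm{CSatSum}_{\mathcal{F}}(\varphi,\mathbf{v},\mathbf{U},h,b)$: if the tie $(\varphi,\mathbf{v},\mathbf{U})$ is satisfiable in $\mathcal{F}$ (oracle query), return true. Otherwise, if $h>1$: for each $k$ with $1\le k\le b$ and each $\mathbf{u},\mathbf{v}_0,\dots,\mathbf{v}_{k-1}\in 2^{\#\varphi}$ with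 $\mathbf{v}=\mathbf{u}+\sum_{i<k}\mathbf{v}_i$: if the tie $(\varphi,\mathbf{u},\mathbf{U}\oplus_a\sum_{i<k}\mathbf{v}_i)$ is satisfiable in $\mathcal{F}$ (oracle query) and $\mathrm{CSatSum}_{\mathcal{F}}(\varphi,\mathbf{v}_i,\mathbf{U},h-1,b)$ returns true for every $i<k$, return true. Finally return false. -}

module Defs where

open import Level using (0ℓ)
open import Data.Nat as ℕ using (ℕ; zero; suc; _≤_; _<_)
open import Data.Nat.Properties as ℕP using ()
open import Data.Fin as Fin using (Fin)
open import Data.Fin.Properties as FinP using ()
open import Data.Bool using (Bool; true; false; T; _∨_; _∧_; not; if_then_else_)
open import Data.List as List using (List; []; _∷_; _++_; length; filterᵇ; deduplicate)
open import Data.Bool.ListAction using (any)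
open import Data.Vec as Vec using (Vec; lookup; fromList; zipWith; replicate)
open import Data.Product using (Σ; Σ-syntax; ∃; _×_; _,_)
open import Data.Sum using (_⊎_)
open import Data.Unit using (⊤)
open import Data.Empty using (⊥)
open import Relation.Nullary using (Dec; yes; no; ¬_)
open import Relation.Nullary.Decidable using (map′)
open import Relation.Binary.PropositionalEquality using (_≡_; _≢_; refl; cong; cong₂)
open import Function.Bundles using (_⇔_)

data Fm (A : ℕ) : Set where
  var  : ℕ → Fm A
  bot  : Fm A
  _⇒_  : Fm A → Fm A → Fm A
  ◇    : Fin A → Fm A → Fm A

infixr 5 _⇒_

_≟F_ : ∀ {A} (φ ψ : Fm A) → Dec (φ ≡ ψ)
var p ≟F var q with p ℕ.≟ q
... | yes refl = yes refl
... | no ne = no λ { refl → ne refl }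
var _ ≟F bot = no λ ()
var _ ≟F (_ ⇒ _) = no λ ()
var _ ≟F ◇ _ _ = no λ ()
bot ≟F var _ = no λ ()
bot ≟F bot = yes refl
bot ≟F (_ ⇒ _) = no λ ()
bot ≟F ◇ _ _ = no λ ()
(_ ⇒ _) ≟F var _ = no λ ()
(_ ⇒ _) ≟F bot = no λ ()
(φ ⇒ ψ) ≟F (φ′ ⇒ ψ′) with φ ≟F φ′ | ψ ≟F ψ′
... | yes refl | yes refl = yes refl
... | no ne | _ = no λ { refl → ne refl }
... | yes _ | no ne = no λ { refl → ne refl }
(_ ⇒ _) ≟F ◇ _ _ = no λ ()
◇ _ _ ≟F var _ = no λ ()
◇ _ _ ≟F bot = no λ ()
◇ _ _ ≟F (_ ⇒ _) = no λ ()
◇ c φ ≟F ◇ d ψ with c Fin.≟ d | φ ≟F ψ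
... | yes refl | yes refl = yes refl
... | no ne | _ = no λ { refl → ne refl }
... | yes _ | no ne = no λ { refl → ne refl }

subOcc : ∀ {A} → Fm A → List (Fm A)
subOcc (var p)   = var p ∷ []
subOcc bot       = bot ∷ []
subOcc (φ ⇒ ψ)   = (φ ⇒ ψ) ∷ subOcc φ ++ subOcc ψ
subOcc (◇ c φ)   = ◇ c φ ∷ subOcc φ

-- the fixed (polynomial-time) list ψ₀ = φ, ψ₁, …, of the distinct subformulas
subList : ∀ {A} → Fm A → List (Fm A)
subList φ = deduplicate _≟F_ (subOcc φ)

#_ : ∀ {A} → Fm A → ℕ
# φ = length (subList φ)

subs : ∀ {A} (φ : Fm A) → Vec (Fm A) (# φ)
subs φ = fromList (subList φ)

record Frame (A : ℕ) : Set₁ where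
  field
    W     : Set
    point : W                       -- W ≠ ∅
    R     : Fin A → W → W → Set

open Frame public

Valuation : ∀ {A} → Frame A → Set₁
Valuation F = ℕ → W F → Set

Condition : ℕ → Set₁
Condition A = Fin A → Fm A → Set

Sat : ∀ {A} (F : Frame A) (θ : Valuation F) (Γ : Condition A) → W F → Fm A → Set
Sat F θ Γ w (var p) = θ p w
Sat F θ Γ w bot     = ⊥
Sat F θ Γ w (φ ⇒ ψ) = Sat F θ Γ w φ → Sat F θ Γ w ψ
Sat F θ Γ w (◇ c φ) = Γ c φ ⊎ Σ[ v ∈ W F ] (R F c w v × Sat F θ Γ v φ)

BVec : ∀ {A} → Fm A → Set
BVec φ = Vec Bool (# φ)

_+V_ : ∀ {n} → Vec Bool n → Vec Bool n → Vec Bool n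
_+V_ = zipWith _∨_

sumV : ∀ {n} (k : ℕ) → (Fin k → Vec Bool n) → Vec Bool n
sumV zero    vs = replicate _ false
sumV (suc k) vs = vs Fin.zero +V sumV k (λ i → vs (Fin.suc i))

_⊕[_]_ : ∀ {A n} → (Fin A → Vec Bool n) → Fin A → Vec Bool n → (Fin A → Vec Bool n)
(U ⊕[ a ] w) c with c Fin.≟ a
... | yes _ = U c +V w
... | no  _ = U c

condOf : ∀ {A} (φ : Fm A) → (Fin A → BVec φ) → Condition A
condOf φ U c ψ = Σ[ i ∈ Fin (# φ) ] (lookup (subs φ) i ≡ ψ × T (lookup (U c) i))

Realizes : ∀ {A} (F : Frame A) (θ : Valuation F) (φ : Fm A) → BVec φ → (Fin A → BVec φ) → Set
Realizes F θ φ v U =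
  ∀ (i : Fin (# φ)) → T (lookup v i) ⇔ (Σ[ w ∈ W F ] Sat F θ (condOf φ U) w (lookup (subs φ) i))

SatIn : ∀ {A} → (Frame A → Set) → (φ : Fm A) → BVec φ → (Fin A → BVec φ) → Set₁
SatIn {A} 𝓕 φ v U = Σ[ F ∈ Frame A ] (𝓕 F × Σ[ θ ∈ Valuation F ] Realizes F θ φ v U)

record Tree : Set where
  field
    size   : ℕ
    S      : Fin size → Fin size → Bool
    irrefl : ∀ x → ¬ T (S x x)
    trans  : ∀ x y z → T (S x y) → T (S y z) → T (S x z)
    root   : Fin size
    least  : ∀ x → x ≢ root → T (S root x)
    predChain : ∀ x y z → T (S y x) → T (S z x) → (y ≡ z) ⊎ T (S y z) ⊎ T (S z y)

open Tree public

-- S-increasing lists  x₁ S x₂ S … S x_k  (these are exactly the finite chains, listed in order)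
IsChain : (t : Tree) → List (Fin (size t)) → Set
IsChain t []           = ⊤
IsChain t (x ∷ [])     = ⊤
IsChain t (x ∷ y ∷ xs) = T (S t x y) × IsChain t (y ∷ xs)

immSucc : (t : Tree) → Fin (size t) → Fin (size t) → Bool
immSucc t x y = S t x y ∧ not (any (λ z → S t x z ∧ S t z y) (List.allFin (size t)))

InTr : ℕ → ℕ → Tree → Set
InTr h b t =
  (∀ (xs : List (Fin (size t))) → IsChain t xs → length xs ≤ h) ×
  (∀ (x : Fin (size t)) → length (filterᵇ (immSucc t x) (List.allFin (size t))) ≤ b)

data SumR {A : ℕ} (a : Fin A) (t : Tree) (Fs : Fin (size t) → Frame A) (c : Fin A) :
          Σ[ i ∈ Fin (size t) ] W (Fs i) → Σ[ i ∈ Fin (size t) ] W (Fs i) → Set where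
  inner : ∀ {i w v} → R (Fs i) c w v → SumR a t Fs c (i , w) (i , v)
  outer : ∀ {i j w v} → i ≢ j → c ≡ a → T (S t i j) → SumR a t Fs c (i , w) (j , v)

sumFrame : ∀ {A} (a : Fin A) (t : Tree) → (Fin (size t) → Frame A) → Frame A
sumFrame a t Fs = record
  { W     = Σ[ i ∈ Fin (size t) ] W (Fs i)
  ; point = root t , point (Fs (root t))
  ; R     = SumR a t Fs
  }

SatInSum : ∀ {A} → (Frame A → Set) → Fin A → ℕ → ℕ →
           (φ : Fm A) → BVec φ → (Fin A → BVec φ) → Set₁
SatInSum {A} 𝓕 a h b φ v U =
  Σ[ t ∈ Tree ] (InTr h b t ×
  Σ[ Fs ∈ (Fin (size t) → Frame A) ] ((∀ i → 𝓕 (Fs i)) ×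
  Σ[ θ ∈ Valuation (sumFrame a t Fs) ] Realizes (sumFrame a t Fs) θ φ v U))

-- "CSatSum_𝓕(φ, v, U, h, b) returns true", with the oracle query
-- "tie satisfiable in 𝓕" read as the proposition SatIn 𝓕.

CSatSum : ∀ {A} → (Frame A → Set) → Fin A →
          (φ : Fm A) → BVec φ → (Fin A → BVec φ) → ℕ → ℕ → Set₁
CSatSum 𝓕 a φ v U zero          b = SatIn 𝓕 φ v U
CSatSum 𝓕 a φ v U (suc zero)    b = SatIn 𝓕 φ v U
CSatSum 𝓕 a φ v U (suc (suc h)) b =
  SatIn 𝓕 φ v U ⊎
  (Σ[ k ∈ ℕ ] (1 ≤ k × k ≤ b ×
   Σ[ u ∈ BVec φ ] Σ[ vs ∈ (Fin k → BVec φ) ]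
     (v ≡ u +V sumV k vs ×
      SatIn 𝓕 φ u (U ⊕[ a ] sumV k vs) ×
      (∀ (i : Fin k) → CSatSum 𝓕 a φ (vs i) U (suc h) b))))

-- An a-sum over a tree is localised by its components: a point (x, w) satisfies a formula under Γ
-- iff w does so in the component F_x under Γ with Γ_a enlarged by the formulas that hold somewhere
-- strictly above x. So if u_x collects the subformulas true in F_x and v_x those true in the cone
-- above x, then v_x = u_x + Σ v_c over the immediate successors c of x, and F_x realises the tie
-- (φ, u_x, U ⊕_a Σ v_c): this is precisely one step of CSatSum, with the height and branching of the
-- tree bounding its recursion depth and its k. Conversely an accepting run of CSatSum is a rose tree
-- of models; grafting them along the run gives an ordered sum over the positions of that rose tree,
-- and enumerating the positions turns it into an a-sum over a finite tree, related to it by a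
-- surjective p-morphism. Excluded middle only serves to read off the vectors u_x and v_x.

module Submission where

open import Defs
open import Level using (0ℓ)
open import Axiom.ExcludedMiddle using (ExcludedMiddle)
open import Data.Nat using (ℕ; zero; suc; _+_; _≤_; _<_; z≤n; s≤s)
open import Data.Nat.Properties using (+-suc; +-identityʳ; +-monoˡ-≤; <⇒≱; ≤-pred; ≤-trans; m<m+n; m≤n+m; module ≤-Reasoning)
open import Data.Fin as Fin using (Fin; _↑ˡ_; _↑ʳ_; splitAt)
open import Data.Fin.Properties using (⊎⇔∃; ¬Fin0; punchIn-punchOut; splitAt-↑ˡ; splitAt-↑ʳ; splitAt⁻¹-↑ˡ; splitAt⁻¹-↑ʳ)
open import Data.Bool using (Bool; true; false; T; _∨_; _∧_; not)
open import Data.Bool.Properties using (T-∨; T-∧; T-not-≡)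
open import Data.Vec using (Vec; lookup; tabulate)
open import Data.Vec.Properties using (lookup-zipWith; lookup-replicate; lookup∘tabulate; tabulate∘lookup; tabulate-cong)
open import Data.Product using (Σ; ∃-syntax; _×_; _,_; proj₁; proj₂)
open import Data.Product.Function.Dependent.Propositional as Σ using ()
open import Data.Sum using (_⊎_; inj₁; inj₂)
open import Data.Sum.Function.Propositional using (_⊎-⇔_)
open import Data.Unit using (tt)
open import Data.List as List using (List; []; _∷_; _++_; length; filterᵇ)
open import Data.List.Membership.Propositional using (_∈_; lose)
open import Data.List.Membership.Propositional.Properties
  using (∈-++⁻; ∈-++⁺ˡ; ∈-++⁺ʳ; ∈-deduplicate⁺; ∈-deduplicate⁻; ∈-filter⁺; ∈-filter⁻; ∈-allFin)
  renaming (∈-lookup to ∈-List-lookup)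
open import Data.List.Relation.Unary.Any using (here; there; satisfied)
import Data.List.Relation.Unary.Any as ListAny
import Data.List.Relation.Unary.All as All
open import Data.List.Relation.Unary.AllPairs using ([]; _∷_)
open import Data.List.Relation.Unary.Unique.Propositional using (Unique)
open import Data.List.Relation.Unary.Unique.Propositional.Properties using (filter⁺; allFin⁺)
open import Data.List.Relation.Unary.Any.Properties using (any⁺; any⁻) renaming (lookup-index to List-lookup-index)
open import Data.Bool.ListAction using (any)
open import Data.Vec.Membership.Propositional.Properties using (∈-lookup; ∈-fromList⁺; ∈-fromList⁻)
import Data.Vec.Relation.Unary.Any as VecAny
open import Data.Vec.Membership.Propositional using () renaming (_∈_ to _∈ᵥ_)
open import Data.Vec.Relation.Unary.Any.Properties using (lookup-index)
open import Data.Product.Function.NonDependent.Propositional using (_×-⇔_)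
open import Data.Empty using (⊥; ⊥-elim)
open import Function using (_∘_)
open import Function.Bundles using (_⇔_; mk⇔; Equivalence)
open import Function.Construct.Symmetry using (⇔-sym)
open import Function.Construct.Identity using (⇔-id)
open import Function.Construct.Composition using (_⇔-∘_)
open import Function.Related.Propositional using (module EquationalReasoning; equivalence)
open import Function.Related.TypeIsomorphisms using (→-cong-⇔)
open import Relation.Nullary using (Dec; yes; no; ¬_; isYes)
open import Relation.Nullary.Decidable using (toWitness; fromWitness; T?)
open import Relation.Binary.PropositionalEquality using (_≡_; _≢_; refl; cong; sym; subst; module ≡-Reasoning) renaming (trans to ≡-trans)

open Equivalence using (to; from)

private module ⇔-Reasoning = EquationalReasoning {k = equivalence}

Σ-cong-⇔ : ∀ {I : Set} {P Q : I → Set} → (∀ i → P i ⇔ Q i) → Σ I P ⇔ Σ I Q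
Σ-cong-⇔ e = Σ.congˡ (e _)

T-injective : ∀ {x y : Bool} → (T x ⇔ T y) → x ≡ y
T-injective {false} {false} _ = refl
T-injective {false} {true}  e = ⊥-elim (from e tt)
T-injective {true}  {false} e = ⊥-elim (to e tt)
T-injective {true}  {true}  _ = refl

BoolVec-ext : ∀ {n} {p q : Vec Bool n} → (∀ i → T (lookup p i) ⇔ T (lookup q i)) → p ≡ q
BoolVec-ext {p = p} {q} e = begin
  p                  ≡⟨ sym (tabulate∘lookup p) ⟩
  tabulate (lookup p) ≡⟨ tabulate-cong (T-injective ∘ e) ⟩
  tabulate (lookup q) ≡⟨ tabulate∘lookup q ⟩
  q                  ∎
  where open ≡-Reasoning

T-lookup-+V : ∀ {n} (p q : Vec Bool n) i → T (lookup (p +V q) i) ⇔ (T (lookup p i) ⊎ T (lookup q i))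
T-lookup-+V p q i rewrite lookup-zipWith _∨_ i p q = T-∨

T-lookup-sumV : ∀ {n} k (vs : Fin k → Vec Bool n) i → T (lookup (sumV k vs) i) ⇔ (∃[ l ] T (lookup (vs l) i))
T-lookup-sumV zero    vs i rewrite lookup-replicate i false = mk⇔ (λ ()) (λ ())
T-lookup-sumV (suc k) vs i = begin
  T (lookup (sumV (suc k) vs) i)                                       ∼⟨ T-lookup-+V (vs Fin.zero) _ i ⟩
  (T (lookup (vs Fin.zero) i) ⊎ T (lookup (sumV k (vs ∘ Fin.suc)) i))   ∼⟨ (⇔-id _ ⊎-⇔ T-lookup-sumV k (vs ∘ Fin.suc) i) ⟩
  (T (lookup (vs Fin.zero) i) ⊎ ∃[ l ] T (lookup (vs (Fin.suc l)) i)) ∼⟨ ⊎⇔∃ ⟩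
  (∃[ l ] T (lookup (vs l) i))                                          ∎
  where open ⇔-Reasoning

indicator : ExcludedMiddle 0ℓ → ∀ {n} → (Fin n → Set) → Vec Bool n
indicator em P = tabulate (λ j → isYes (em {P j}))

T-lookup-indicator : (em : ExcludedMiddle 0ℓ) → ∀ {n} (P : Fin n → Set) j → T (lookup (indicator em P) j) ⇔ P j
T-lookup-indicator em P j rewrite lookup∘tabulate (λ j → isYes (em {P j})) j = mk⇔ toWitness fromWitness

subOcc-refl : ∀ {A} (φ : Fm A) → φ ∈ subOcc φ
subOcc-refl (var p) = here refl
subOcc-refl bot     = here refl
subOcc-refl (φ ⇒ ψ) = here refl
subOcc-refl (◇ c φ) = here refl

subOcc-trans : ∀ {A} (φ : Fm A) {ψ χ} → ψ ∈ subOcc φ → χ ∈ subOcc ψ → χ ∈ subOcc φ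
subOcc-trans (var p) (here refl) m = m
subOcc-trans bot     (here refl) m = m
subOcc-trans (φ ⇒ ψ) (here refl) m = m
subOcc-trans (φ ⇒ ψ) (there k)   m with ∈-++⁻ (subOcc φ) k
... | inj₁ k∈φ = there (∈-++⁺ˡ (subOcc-trans φ k∈φ m))
... | inj₂ k∈ψ = there (∈-++⁺ʳ (subOcc φ) (subOcc-trans ψ k∈ψ m))
subOcc-trans (◇ c φ) (here refl) m = m
subOcc-trans (◇ c φ) (there k)   m = there (subOcc-trans φ k m)

subs-subOcc : ∀ {A} (φ : Fm A) i → lookup (subs φ) i ∈ subOcc φ
subs-subOcc φ i = ∈-deduplicate⁻ _≟F_ (subOcc φ) (∈-fromList⁻ (∈-lookup i (subs φ)))

subOcc-index : ∀ {A} (φ : Fm A) {χ} → χ ∈ subOcc φ → ∃[ i ] lookup (subs φ) i ≡ χ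
subOcc-index φ {χ} χ∈φ = VecAny.index χ∈subs , sym (lookup-index χ∈subs)
  where
  χ∈subs : χ ∈ᵥ subs φ
  χ∈subs = ∈-fromList⁺ (∈-deduplicate⁺ _≟F_ χ∈φ)

Sat-cong : ∀ {A} (F : Frame A) (θ : Valuation F) {Γ Δ : Condition A} ψ →
  (∀ c χ → χ ∈ subOcc ψ → Γ c χ ⇔ Δ c χ) → ∀ w → Sat F θ Γ w ψ ⇔ Sat F θ Δ w ψ
Sat-cong F θ (var p) Γ≐Δ w = ⇔-id _
Sat-cong F θ bot     Γ≐Δ w = ⇔-id _
Sat-cong F θ (ψ ⇒ χ) Γ≐Δ w =
  →-cong-⇔ (Sat-cong F θ ψ (λ c ξ m → Γ≐Δ c ξ (there (∈-++⁺ˡ m))) w)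
           (Sat-cong F θ χ (λ c ξ m → Γ≐Δ c ξ (there (∈-++⁺ʳ (subOcc ψ) m))) w)
Sat-cong F θ (◇ c ψ) Γ≐Δ w =
  Γ≐Δ c ψ (there (subOcc-refl ψ)) ⊎-⇔
  Σ-cong-⇔ (λ v → ⇔-id _ ×-⇔ Sat-cong F θ ψ (λ c ξ m → Γ≐Δ c ξ (there m)) v)

Sat-cong-subs : ∀ {A} (F : Frame A) (θ : Valuation F) {Γ Δ : Condition A} (φ : Fm A) →
  (∀ c χ → χ ∈ subOcc φ → Γ c χ ⇔ Δ c χ) →
  ∀ i w → Sat F θ Γ w (lookup (subs φ) i) ⇔ Sat F θ Δ w (lookup (subs φ) i)
Sat-cong-subs F θ φ Γ≐Δ i = Sat-cong F θ _ (λ c χ m → Γ≐Δ c χ (subOcc-trans φ (subs-subOcc φ i) m))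

extend : ∀ {A} → Condition A → Fin A → (Fm A → Set) → Condition A
extend Γ a E c χ = Γ c χ ⊎ (c ≡ a × E χ)

condOf-⊕ : ∀ {A} (φ : Fm A) (U : Fin A → BVec φ) (a : Fin A) (V : BVec φ) {E : Fm A → Set} →
  (∀ i → T (lookup V i) ⇔ E (lookup (subs φ) i)) →
  ∀ c χ → χ ∈ subOcc φ → condOf φ (U ⊕[ a ] V) c χ ⇔ extend (condOf φ U) a E c χ
condOf-⊕ φ U a V {E} V≐E c χ χ∈φ with c Fin.≟ a
... | no c≢a   = mk⇔ inj₁ λ { (inj₁ γ) → γ ; (inj₂ (c≡a , _)) → ⊥-elim (c≢a c≡a) }
... | yes refl = mk⇔ split join
  where
  split : ∃[ i ] lookup (subs φ) i ≡ χ × T (lookup (U a +V V) i) → extend (condOf φ U) a E a χ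
  split (i , ψᵢ≡χ , t) with to (T-lookup-+V (U a) V i) t
  ... | inj₁ u = inj₁ (i , ψᵢ≡χ , u)
  ... | inj₂ v = inj₂ (refl , subst E ψᵢ≡χ (to (V≐E i) v))
  join : extend (condOf φ U) a E a χ → ∃[ i ] lookup (subs φ) i ≡ χ × T (lookup (U a +V V) i)
  join (inj₁ (i , ψᵢ≡χ , u)) = i , ψᵢ≡χ , from (T-lookup-+V (U a) V i) (inj₁ u)
  join (inj₂ (_ , e)) with subOcc-index φ χ∈φ
  ... | i , ψᵢ≡χ = i , ψᵢ≡χ , from (T-lookup-+V (U a) V i) (inj₂ (from (V≐E i) (subst E (sym ψᵢ≡χ) e)))

record PMorphism {A} (F G : Frame A) (θF : Valuation F) (θG : Valuation G) : Set where
  field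
    map   : W F → W G
    val   : ∀ p w → θF p w ⇔ θG p (map w)
    forth : ∀ c {w w′} → R F c w w′ → R G c (map w) (map w′)
    back  : ∀ c {w z} → R G c (map w) z → ∃[ w′ ] R F c w w′ × map w′ ≡ z

module _ {A} {F G : Frame A} {θF : Valuation F} {θG : Valuation G} (m : PMorphism F G θF θG) where
  open PMorphism m

  Sat-pmorphism : ∀ Γ ψ w → Sat F θF Γ w ψ ⇔ Sat G θG Γ (map w) ψ
  Sat-pmorphism Γ (var p) w = val p w
  Sat-pmorphism Γ bot     w = ⇔-id _
  Sat-pmorphism Γ (ψ ⇒ χ) w = →-cong-⇔ (Sat-pmorphism Γ ψ w) (Sat-pmorphism Γ χ w)
  Sat-pmorphism Γ (◇ c ψ) w = ⇔-id _ ⊎-⇔ mk⇔ forward backward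
    where
    forward : (∃[ w′ ] R F c w w′ × Sat F θF Γ w′ ψ) → ∃[ z ] R G c (map w) z × Sat G θG Γ z ψ
    forward (w′ , r , s) = map w′ , forth c r , to (Sat-pmorphism Γ ψ w′) s
    backward : (∃[ z ] R G c (map w) z × Sat G θG Γ z ψ) → ∃[ w′ ] R F c w w′ × Sat F θF Γ w′ ψ
    backward (z , r , s) with back c r
    ... | w′ , r′ , refl = w′ , r′ , from (Sat-pmorphism Γ ψ w′) s

  module _ (surjective : ∀ z → ∃[ w ] map w ≡ z) where

    ∃Sat-pmorphism : ∀ Γ ψ → (∃[ w ] Sat F θF Γ w ψ) ⇔ (∃[ z ] Sat G θG Γ z ψ)
    ∃Sat-pmorphism Γ ψ = mk⇔
      (λ (w , s) → map w , to (Sat-pmorphism Γ ψ w) s)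
      (λ (z , s) → let (w , mw≡z) = surjective z in
                   w , from (Sat-pmorphism Γ ψ w) (subst (λ z → Sat G θG Γ z ψ) (sym mw≡z) s))

    Realizes-pmorphism : ∀ φ v U → Realizes F θF φ v U ⇔ Realizes G θG φ v U
    Realizes-pmorphism φ v U = mk⇔
      (λ real i → ∃Sat-pmorphism (condOf φ U) (lookup (subs φ) i) ⇔-∘ real i)
      (λ real i → ⇔-sym (∃Sat-pmorphism (condOf φ U) (lookup (subs φ) i)) ⇔-∘ real i)

module OrderedSum {A} (a : Fin A) {I : Set} (_≺_ : I → I → Set)
                  (Fs : I → Frame A) (θs : ∀ i → Valuation (Fs i)) (i₀ : I) where

  -- As in sumFrame, but without the side condition i ≢ j, which is vacuous when ≺ is irreflexive.
  data Step (c : Fin A) : Σ I (W ∘ Fs) → Σ I (W ∘ Fs) → Set where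
    inner : ∀ {i w v} → R (Fs i) c w v → Step c (i , w) (i , v)
    outer : ∀ {i j w v} → c ≡ a → i ≺ j → Step c (i , w) (j , v)

  frame : Frame A
  frame = record { W = Σ I (W ∘ Fs) ; point = i₀ , point (Fs i₀) ; R = Step }

  val : Valuation frame
  val p (i , w) = θs i p w

  module _ (Γ : Condition A) where

    SatAt : I → Fm A → Set
    SatAt i χ = ∃[ w ] Sat frame val Γ (i , w) χ

    Above : I → Fm A → Set
    Above i χ = ∃[ j ] i ≺ j × SatAt j χ

    Cone : I → Fm A → Set
    Cone i χ = ∃[ j ] (j ≡ i ⊎ i ≺ j) × SatAt j χ

    localise : ∀ χ i w → Sat frame val Γ (i , w) χ ⇔ Sat (Fs i) (θs i) (extend Γ a (Above i)) w χ
    localise (var p) i w = ⇔-id _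
    localise bot     i w = ⇔-id _
    localise (χ ⇒ ξ) i w = →-cong-⇔ (localise χ i w) (localise ξ i w)
    localise (◇ c χ) i w = mk⇔ forward backward
      where
      forward : Sat frame val Γ (i , w) (◇ c χ) → Sat (Fs i) (θs i) (extend Γ a (Above i)) w (◇ c χ)
      forward (inj₁ γ)                             = inj₁ (inj₁ γ)
      forward (inj₂ ((i , v) , inner r , s))       = inj₂ (v , r , to (localise χ i v) s)
      forward (inj₂ ((j , v) , outer c≡a i≺j , s)) = inj₁ (inj₂ (c≡a , j , i≺j , v , s))
      backward : Sat (Fs i) (θs i) (extend Γ a (Above i)) w (◇ c χ) → Sat frame val Γ (i , w) (◇ c χ)
      backward (inj₁ (inj₁ γ))                         = inj₁ γ
      backward (inj₁ (inj₂ (c≡a , j , i≺j , v , s))) = inj₂ ((j , v) , outer c≡a i≺j , s)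
      backward (inj₂ (v , r , s))                      = inj₂ ((i , v) , inner r , from (localise χ i v) s)

    Cone-split : ∀ i χ → Cone i χ ⇔ (SatAt i χ ⊎ Above i χ)
    Cone-split i χ = mk⇔
      (λ { (j , inj₁ refl , s) → inj₁ s ; (j , inj₂ i≺j , s) → inj₂ (j , i≺j , s) })
      (λ { (inj₁ s) → i , inj₁ refl , s ; (inj₂ (j , i≺j , s)) → j , inj₂ i≺j , s })

    module _ {i} (maximal : ∀ j → ¬ i ≺ j) where

      Cone-maximal : ∀ χ → Cone i χ ⇔ SatAt i χ
      Cone-maximal χ = mk⇔ (λ { (inj₁ s) → s ; (inj₂ (j , i≺j , _)) → ⊥-elim (maximal j i≺j) }) inj₁ ⇔-∘ Cone-split i χ

      extend-maximal : ∀ c χ → extend Γ a (Above i) c χ ⇔ Γ c χ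
      extend-maximal c χ = mk⇔ (λ { (inj₁ γ) → γ ; (inj₂ (_ , j , i≺j , _)) → ⊥-elim (maximal j i≺j) }) inj₁

    ∃Sat-Cone : (∀ i → i ≡ i₀ ⊎ i₀ ≺ i) → ∀ χ → (∃[ z ] Sat frame val Γ z χ) ⇔ Cone i₀ χ
    ∃Sat-Cone rooted χ = mk⇔ (λ ((i , w) , s) → i , rooted i , w , s) (λ (i , _ , w , s) → (i , w) , s)

    Above-children : (∀ {i j k} → i ≺ j → j ≺ k → i ≺ k) →
      ∀ {k} i (ch : Fin k → I) → (∀ l → i ≺ ch l) → (∀ j → i ≺ j → ∃[ l ] (j ≡ ch l ⊎ ch l ≺ j)) →
      ∀ χ → Above i χ ⇔ (∃[ l ] Cone (ch l) χ)
    Above-children ≺-trans i ch i≺ch covered χ = mk⇔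
      (λ (j , i≺j , s) → let (l , j≽chl) = covered j i≺j in l , j , j≽chl , s)
      (λ { (l , j , inj₁ refl , s) → j , i≺ch l , s ; (l , j , inj₂ chl≺j , s) → j , ≺-trans (i≺ch l) chl≺j , s })

module TreeFacts (t : Tree) where

  Node : Set
  Node = Fin (size t)

  _⊰_ : Node → Node → Set
  x ⊰ y = T (S t x y)

  Height≤ : ℕ → Node → Set
  Height≤ H x = ∀ xs → IsChain t (x ∷ xs) → length (x ∷ xs) ≤ H

  Height≤-succ : ∀ {H x y} → Height≤ (suc H) x → x ⊰ y → Height≤ H y
  Height≤-succ ht x⊰y xs chain = ≤-pred (ht (_ ∷ xs) (x⊰y , chain))

  children : Node → List Node
  children x = filterᵇ (immSucc t x) (List.allFin (size t))

  children-succ : ∀ x l → x ⊰ List.lookup (children x) l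
  children-succ x l = proj₁ (to T-∧ (proj₂ (∈-filter⁻ (T? ∘ immSucc t x) {xs = List.allFin (size t)} (∈-List-lookup l))))

  intermediate : ∀ {x y} → x ⊰ y → ¬ T (immSucc t x y) → ∃[ z ] x ⊰ z × z ⊰ y
  intermediate {x} {y} x⊰y ¬imm with any (λ z → S t x z ∧ S t z y) (List.allFin (size t)) in eq
  ... | true  = let (z , between) = satisfied (any⁻ _ (List.allFin (size t)) (subst T (sym eq) tt))
                in z , to T-∧ between
  ... | false = ⊥-elim (¬imm (from T-∧ (x⊰y , tt)))

  immSucc-below : ∀ {H x y} → Height≤ H x → x ⊰ y → ∃[ c ] T (immSucc t x c) × (y ≡ c ⊎ c ⊰ y)
  immSucc-below {H} {x} ht x⊰y = descend H _ [] (x⊰y , tt) (m<m+n H (s≤s z≤n))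
    where
    -- Refine x ⊰ y to x ⊰ z ⊰ y until y is immediate; the chain x ⊰ … ⊰ y grows, and the height bounds it.
    descend : ∀ n y ys → IsChain t (x ∷ y ∷ ys) → H < n + length (x ∷ y ∷ ys) →
              ∃[ c ] T (immSucc t x c) × (y ≡ c ⊎ c ⊰ y)
    descend zero    y ys chain H<len = ⊥-elim (<⇒≱ H<len (ht (y ∷ ys) chain))
    descend (suc n) y ys chain H<len with T? (immSucc t x y)
    ... | yes imm = y , imm , inj₁ refl
    ... | no ¬imm with intermediate (proj₁ chain) ¬imm
    ...   | z , x⊰z , z⊰y with descend n z (y ∷ ys) (x⊰z , z⊰y , proj₂ chain)
                                   (subst (H <_) (sym (+-suc n _)) H<len)
    ...     | c , imm , inj₁ refl = c , imm , inj₂ z⊰y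
    ...     | c , imm , inj₂ c⊰z  = c , imm , inj₂ (Tree.trans t c z y c⊰z z⊰y)

  succ-above-child : ∀ {H x y} → Height≤ H x → x ⊰ y →
    ∃[ l ] (y ≡ List.lookup (children x) l ⊎ List.lookup (children x) l ⊰ y)
  succ-above-child {x = x} ht x⊰y with immSucc-below ht x⊰y
  ... | c , imm , y≽c with ∈-filter⁺ (T? ∘ immSucc t x) (∈-allFin c) imm
  ...   | c∈children rewrite List-lookup-index c∈children = ListAny.index c∈children , y≽c

module Soundness (em : ExcludedMiddle 0ℓ) {A} (a : Fin A) (𝓕 : Frame A → Set)
                 (φ : Fm A) (U : Fin A → BVec φ) (b : ℕ) (t : Tree)
                 (Fs : Fin (size t) → Frame A) (𝓕Fs : ∀ x → 𝓕 (Fs x))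
                 (θ : Valuation (sumFrame a t Fs)) where
  open TreeFacts t

  θs : ∀ x → Valuation (Fs x)
  θs x p w = θ p (x , w)

  open OrderedSum a _⊰_ Fs θs (root t)

  Γ : Condition A
  Γ = condOf φ U

  ψ : Fin (# φ) → Fm A
  ψ = lookup (subs φ)

  sumFrame-pmorphism : PMorphism (sumFrame a t Fs) frame θ val
  sumFrame-pmorphism = record
    { map   = λ z → z
    ; val   = λ _ _ → ⇔-id _
    ; forth = λ { c (inner r) → inner r ; c (outer _ c≡a x⊰y) → outer c≡a x⊰y }
    ; back  = λ { c (inner r) → _ , inner r , refl
                ; c (outer c≡a x⊰y) → _ , outer (λ { refl → irrefl t _ x⊰y }) c≡a x⊰y , refl }
    }

  nodeVec coneVec : Node → BVec φ
  nodeVec x = indicator em (λ j → SatAt Γ x (ψ j))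
  coneVec x = indicator em (λ j → Cone Γ x (ψ j))

  component-SatIn : ∀ x U′ → (∀ c χ → χ ∈ subOcc φ → condOf φ U′ c χ ⇔ extend Γ a (Above Γ x) c χ) →
    SatIn 𝓕 φ (nodeVec x) U′
  component-SatIn x U′ U′≐Γₓ = Fs x , 𝓕Fs x , θs x , λ j → begin
    T (lookup (nodeVec x) j)                                    ∼⟨ T-lookup-indicator em _ j ⟩
    (∃[ w ] Sat frame val Γ (x , w) (ψ j))                      ∼⟨ Σ-cong-⇔ (localise Γ (ψ j) x) ⟩
    (∃[ w ] Sat (Fs x) (θs x) (extend Γ a (Above Γ x)) w (ψ j)) ∼⟨ Σ-cong-⇔ (⇔-sym ∘ Sat-cong-subs (Fs x) (θs x) φ U′≐Γₓ j) ⟩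
    (∃[ w ] Sat (Fs x) (θs x) (condOf φ U′) w (ψ j))            ∎
    where open ⇔-Reasoning

  leaf-SatIn : ∀ x → (∀ y → ¬ x ⊰ y) → SatIn 𝓕 φ (coneVec x) U
  leaf-SatIn x maximal = subst (λ v → SatIn 𝓕 φ v U) nodeVec≡coneVec
    (component-SatIn x U (λ c χ _ → ⇔-sym (extend-maximal Γ maximal c χ)))
    where
    nodeVec≡coneVec : nodeVec x ≡ coneVec x
    nodeVec≡coneVec = BoolVec-ext λ j → begin
      T (lookup (nodeVec x) j)  ∼⟨ T-lookup-indicator em _ j ⟩
      SatAt Γ x (ψ j)           ∼⟨ ⇔-sym (Cone-maximal Γ maximal (ψ j)) ⟩
      Cone Γ x (ψ j)            ∼⟨ ⇔-sym (T-lookup-indicator em _ j) ⟩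
      T (lookup (coneVec x) j)  ∎
      where open ⇔-Reasoning

  module Branching (x : Node) {k} (ch : Fin (suc k) → Node) (x⊰ch : ∀ l → x ⊰ ch l)
                   (covered : ∀ y → x ⊰ y → ∃[ l ] (y ≡ ch l ⊎ ch l ⊰ y)) where

    V : BVec φ
    V = sumV (suc k) (coneVec ∘ ch)

    V≐Above : ∀ j → T (lookup V j) ⇔ Above Γ x (ψ j)
    V≐Above j = begin
      T (lookup V j)                          ∼⟨ T-lookup-sumV (suc k) (coneVec ∘ ch) j ⟩
      (∃[ l ] T (lookup (coneVec (ch l)) j)) ∼⟨ Σ-cong-⇔ (λ l → T-lookup-indicator em _ j) ⟩
      (∃[ l ] Cone Γ (ch l) (ψ j))           ∼⟨ ⇔-sym (Above-children Γ (Tree.trans t _ _ _) x ch x⊰ch covered (ψ j)) ⟩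
      Above Γ x (ψ j)                         ∎
      where open ⇔-Reasoning

    coneVec-split : coneVec x ≡ nodeVec x +V V
    coneVec-split = BoolVec-ext λ j → begin
      T (lookup (coneVec x) j)                    ∼⟨ T-lookup-indicator em _ j ⟩
      Cone Γ x (ψ j)                              ∼⟨ Cone-split Γ x (ψ j) ⟩
      (SatAt Γ x (ψ j) ⊎ Above Γ x (ψ j))         ∼⟨ (⇔-sym (T-lookup-indicator em _ j) ⊎-⇔ ⇔-sym (V≐Above j)) ⟩
      (T (lookup (nodeVec x) j) ⊎ T (lookup V j)) ∼⟨ ⇔-sym (T-lookup-+V (nodeVec x) V j) ⟩
      T (lookup (nodeVec x +V V) j)               ∎
      where open ⇔-Reasoning

    node-SatIn : SatIn 𝓕 φ (nodeVec x) (U ⊕[ a ] V)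
    node-SatIn = component-SatIn x (U ⊕[ a ] V) (condOf-⊕ φ U a V V≐Above)

  branching-CSatSum : ∀ H x {k} (ch : Fin k → Node) → (∀ l → x ⊰ ch l) →
    (∀ y → x ⊰ y → ∃[ l ] (y ≡ ch l ⊎ ch l ⊰ y)) → k ≤ b →
    (∀ l → CSatSum 𝓕 a φ (coneVec (ch l)) U (suc H) b) → CSatSum 𝓕 a φ (coneVec x) U (suc (suc H)) b
  branching-CSatSum H x {zero} ch _ covered _ _ =
    inj₁ (leaf-SatIn x λ y x⊰y → ¬Fin0 (proj₁ (covered y x⊰y)))
  branching-CSatSum H x {suc k} ch x⊰ch covered k≤b below =
    inj₂ (suc k , s≤s z≤n , k≤b , nodeVec x , coneVec ∘ ch , coneVec-split , node-SatIn , below)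
    where open Branching x ch x⊰ch covered

  coneVec-CSatSum : (∀ x → length (children x) ≤ b) → ∀ H x → Height≤ H x → CSatSum 𝓕 a φ (coneVec x) U H b
  coneVec-CSatSum _ zero x ht with ht [] tt
  ... | ()
  coneVec-CSatSum _ (suc zero) x ht = leaf-SatIn x λ y x⊰y → 2≰1 (ht (y ∷ []) (x⊰y , tt))
    where 2≰1 : ¬ 2 ≤ 1
          2≰1 (s≤s ())
  coneVec-CSatSum branching (suc (suc H)) x ht =
    branching-CSatSum H x (List.lookup (children x)) (children-succ x) (λ y → succ-above-child ht) (branching x)
      (λ l → coneVec-CSatSum branching (suc H) _ (Height≤-succ ht (children-succ x l)))

  rooted : ∀ y → y ≡ root t ⊎ root t ⊰ y
  rooted y with y Fin.≟ root t
  ... | yes y≡root = inj₁ y≡root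
  ... | no  y≢root = inj₂ (least t y y≢root)

  soundness : ∀ h v → InTr h b t → Realizes (sumFrame a t Fs) θ φ v U → CSatSum 𝓕 a φ v U h b
  soundness h v (height , branching) real = subst (λ v → CSatSum 𝓕 a φ v U h b) coneVec≡v
    (coneVec-CSatSum branching h (root t) (λ xs → height (root t ∷ xs)))
    where
    coneVec≡v : coneVec (root t) ≡ v
    coneVec≡v = BoolVec-ext λ j → begin
      T (lookup (coneVec (root t)) j)     ∼⟨ T-lookup-indicator em _ j ⟩
      Cone Γ (root t) (ψ j)               ∼⟨ ⇔-sym (∃Sat-Cone Γ rooted (ψ j)) ⟩
      (∃[ z ] Sat frame val Γ z (ψ j))    ∼⟨ ⇔-sym (to (Realizes-pmorphism sumFrame-pmorphism (_, refl) φ v U) real j) ⟩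
      T (lookup v j)                      ∎
      where open ⇔-Reasoning

data Shape : Set where
  node : (k : ℕ) → (Fin k → Shape) → Shape

data Pos : Shape → Set where
  here  : ∀ {k ts} → Pos (node k ts)
  there : ∀ {k ts} (i : Fin k) → Pos (ts i) → Pos (node k ts)

data _⊏_ : ∀ {s} → Pos s → Pos s → Set where
  here⊏  : ∀ {k ts} {i : Fin k} {q : Pos (ts i)} → here ⊏ there {k} {ts} i q
  there⊏ : ∀ {k ts} {i : Fin k} {p q : Pos (ts i)} → p ⊏ q → there {k} {ts} i p ⊏ there i q

rootPos : ∀ s → Pos s
rootPos (node k ts) = here

rootPos-least : ∀ {s} (p : Pos s) → p ≡ rootPos s ⊎ rootPos s ⊏ p
rootPos-least here        = inj₁ refl
rootPos-least (there i p) = inj₂ here⊏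

⊏-irrefl : ∀ {s} {p : Pos s} → ¬ p ⊏ p
⊏-irrefl (there⊏ p⊏p) = ⊏-irrefl p⊏p

⊏-trans : ∀ {s} {p q r : Pos s} → p ⊏ q → q ⊏ r → p ⊏ r
⊏-trans here⊏        (there⊏ _)   = here⊏
⊏-trans (there⊏ p⊏q) (there⊏ q⊏r) = there⊏ (⊏-trans p⊏q q⊏r)

⊏-predecessors-chain : ∀ {s} {p q r : Pos s} → q ⊏ p → r ⊏ p → q ≡ r ⊎ q ⊏ r ⊎ r ⊏ q
⊏-predecessors-chain here⊏        here⊏        = inj₁ refl
⊏-predecessors-chain here⊏        (there⊏ _)   = inj₂ (inj₁ here⊏)
⊏-predecessors-chain (there⊏ _)   here⊏        = inj₂ (inj₂ here⊏)
⊏-predecessors-chain (there⊏ q⊏p) (there⊏ r⊏p) with ⊏-predecessors-chain q⊏p r⊏p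
... | inj₁ refl        = inj₁ refl
... | inj₂ (inj₁ q⊏r) = inj₂ (inj₁ (there⊏ q⊏r))
... | inj₂ (inj₂ r⊏q) = inj₂ (inj₂ (there⊏ r⊏q))

_⊏?_ : ∀ {s} (p q : Pos s) → Dec (p ⊏ q)
here      ⊏? here      = no λ ()
here      ⊏? there i q = yes here⊏
there i p ⊏? here      = no λ ()
there i p ⊏? there j q with i Fin.≟ j
... | no i≢j   = no λ { (there⊏ _) → i≢j refl }
... | yes refl with p ⊏? q
...   | yes p⊏q = yes (there⊏ p⊏q)
...   | no p⊄q  = no λ { (there⊏ p⊏q) → p⊄q p⊏q }

depth : ∀ {s} → Pos s → ℕ
depth here        = 0
depth (there i p) = suc (depth p)

⊏-depth : ∀ {s} {p q : Pos s} → p ⊏ q → depth p < depth q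
⊏-depth here⊏        = s≤s z≤n
⊏-depth (there⊏ p⊏q) = s≤s (⊏-depth p⊏q)

arity : ∀ {s} → Pos s → ℕ
arity {node k ts} here = k
arity (there i p)      = arity p

child : ∀ {s} (p : Pos s) → Fin (arity p) → Pos s
child {node k ts} here l = there l (rootPos (ts l))
child (there i p)      l = there i (child p l)

⊏-child-or-between : ∀ {s} {p q : Pos s} → p ⊏ q → (∃[ l ] q ≡ child p l) ⊎ (∃[ r ] p ⊏ r × r ⊏ q)
⊏-child-or-between (here⊏ {i = i} {q = q}) with rootPos-least q
... | inj₁ refl     = inj₁ (i , refl)
... | inj₂ root⊏q   = inj₂ (there i (rootPos _) , here⊏ , there⊏ root⊏q)
⊏-child-or-between (there⊏ p⊏q) with ⊏-child-or-between p⊏q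
... | inj₁ (l , refl)          = inj₁ (l , refl)
... | inj₂ (r , p⊏r , r⊏q)     = inj₂ (there _ r , there⊏ p⊏r , there⊏ r⊏q)

Fits : ℕ → ℕ → Shape → Set
Fits zero    b s           = ⊥
Fits (suc H) b (node k ts) = k ≤ b × (∀ i → Fits H b (ts i))

Fits-depth : ∀ {H b s} → Fits H b s → (p : Pos s) → depth p < H
Fits-depth {suc H} {s = node k ts} fits       here        = s≤s z≤n
Fits-depth {suc H} {s = node k ts} (_ , fits) (there i p) = s≤s (Fits-depth (fits i) p)

Fits-arity : ∀ {H b s} → Fits H b s → (p : Pos s) → arity p ≤ b
Fits-arity {suc H} {s = node k ts} (k≤b , _)  here        = k≤b
Fits-arity {suc H} {s = node k ts} (_ , fits) (there i p) = Fits-arity (fits i) p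

∑ : ∀ k → (Fin k → ℕ) → ℕ
∑ zero    f = 0
∑ (suc k) f = f Fin.zero + ∑ k (f ∘ Fin.suc)

encodeΣ : ∀ k (f : Fin k → ℕ) → Σ (Fin k) (Fin ∘ f) → Fin (∑ k f)
encodeΣ (suc k) f (Fin.zero  , x) = x ↑ˡ _
encodeΣ (suc k) f (Fin.suc i , x) = f Fin.zero ↑ʳ encodeΣ k (f ∘ Fin.suc) (i , x)

decodeΣ : ∀ k (f : Fin k → ℕ) → Fin (∑ k f) → Σ (Fin k) (Fin ∘ f)
decodeΣ (suc k) f y with splitAt (f Fin.zero) y
... | inj₁ x = Fin.zero , x
... | inj₂ z with decodeΣ k (f ∘ Fin.suc) z
...   | i , x = Fin.suc i , x

decodeΣ-encodeΣ : ∀ k f p → decodeΣ k f (encodeΣ k f p) ≡ p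
decodeΣ-encodeΣ (suc k) f (Fin.zero , x)
  rewrite splitAt-↑ˡ (f Fin.zero) x (∑ k (f ∘ Fin.suc)) = refl
decodeΣ-encodeΣ (suc k) f (Fin.suc i , x)
  rewrite splitAt-↑ʳ (f Fin.zero) (∑ k (f ∘ Fin.suc)) (encodeΣ k (f ∘ Fin.suc) (i , x))
        | decodeΣ-encodeΣ k (f ∘ Fin.suc) (i , x) = refl

encodeΣ-decodeΣ : ∀ k f y → encodeΣ k f (decodeΣ k f y) ≡ y
encodeΣ-decodeΣ (suc k) f y with splitAt (f Fin.zero) y in split≡
... | inj₁ x = splitAt⁻¹-↑ˡ split≡
... | inj₂ z with decodeΣ k (f ∘ Fin.suc) z in decode≡
...   | i , x = ≡-trans (cong (f Fin.zero ↑ʳ_) (≡-trans (cong (encodeΣ k (f ∘ Fin.suc)) (sym decode≡))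
                                                     (encodeΣ-decodeΣ k (f ∘ Fin.suc) z)))
                      (splitAt⁻¹-↑ʳ split≡)

-- Positions are enumerated in preorder: the root, then the positions of each subtree in turn.
card : Shape → ℕ
card (node k ts) = suc (∑ k (card ∘ ts))

encode : ∀ {s} → Pos s → Fin (card s)
encode here                    = Fin.zero
encode {node k ts} (there i p) = Fin.suc (encodeΣ k (card ∘ ts) (i , encode p))

decode : ∀ {s} → Fin (card s) → Pos s
decode {node k ts} Fin.zero = here
decode {node k ts} (Fin.suc y) with decodeΣ k (card ∘ ts) y
... | i , x = there i (decode x)

decode-encode : ∀ {s} (p : Pos s) → decode (encode p) ≡ p
decode-encode {node k ts} here = refl
decode-encode {node k ts} (there i p)
  rewrite decodeΣ-encodeΣ k (card ∘ ts) (i , encode p) = cong (there i) (decode-encode p)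

encode-decode : ∀ {s} (y : Fin (card s)) → encode (decode {s} y) ≡ y
encode-decode {node k ts} Fin.zero = refl
encode-decode {node k ts} (Fin.suc y) with decodeΣ k (card ∘ ts) y in decode≡
... | i , x = cong Fin.suc (begin
  encodeΣ k (card ∘ ts) (i , encode (decode x))  ≡⟨ cong (λ x → encodeΣ k (card ∘ ts) (i , x)) (encode-decode x) ⟩
  encodeΣ k (card ∘ ts) (i , x)                   ≡⟨ cong (encodeΣ k (card ∘ ts)) (sym decode≡) ⟩
  encodeΣ k (card ∘ ts) (decodeΣ k (card ∘ ts) y) ≡⟨ encodeΣ-decodeΣ k (card ∘ ts) y ⟩
  y                                                ∎)
  where open ≡-Reasoning

decode-injective : ∀ {s} {x y : Fin (card s)} → decode {s} x ≡ decode y → x ≡ y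
decode-injective {s} {x} {y} eq = ≡-trans (sym (encode-decode {s} x)) (≡-trans (cong encode eq) (encode-decode y))

Unique-⊆-image⇒length≤ : ∀ {X : Set} {xs : List X} k (g : Fin k → X) → Unique xs →
  (∀ {y} → y ∈ xs → ∃[ i ] y ≡ g i) → length xs ≤ k
Unique-⊆-image⇒length≤ k g [] covered = z≤n
Unique-⊆-image⇒length≤ zero g (_ ∷ _) covered = ⊥-elim (¬Fin0 (proj₁ (covered (here refl))))
Unique-⊆-image⇒length≤ {xs = x ∷ xs} (suc k) g (x∉xs ∷ unique) covered =
  s≤s (Unique-⊆-image⇒length≤ k (g ∘ Fin.punchIn i₀) unique covered′)
  where
  i₀ : Fin (suc k)
  i₀ = proj₁ (covered (here refl))
  covered′ : ∀ {y} → y ∈ xs → ∃[ i ] y ≡ g (Fin.punchIn i₀ i)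
  covered′ y∈xs with covered (there y∈xs)
  ... | j , y≡gj = Fin.punchOut i₀≢j , ≡-trans y≡gj (cong g (sym (punchIn-punchOut i₀≢j)))
    where
    i₀≢j : i₀ ≢ j
    i₀≢j i₀≡j = All.lookup x∉xs y∈xs (≡-trans (proj₂ (covered (here refl))) (≡-trans (cong g i₀≡j) (sym y≡gj)))

module ShapeTree (s : Shape) where

  _⊏ᵇ_ : Fin (card s) → Fin (card s) → Bool
  x ⊏ᵇ y = isYes (decode x ⊏? decode y)

  T-⊏ᵇ : ∀ {x y} → T (x ⊏ᵇ y) ⇔ decode x ⊏ decode y
  T-⊏ᵇ = mk⇔ toWitness fromWitness

  least-encode-root : ∀ x → x ≢ encode (rootPos s) → T (encode (rootPos s) ⊏ᵇ x)
  least-encode-root x x≢root with rootPos-least (decode x)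
  ... | inj₁ x≡root = ⊥-elim (x≢root (≡-trans (sym (encode-decode x)) (cong encode x≡root)))
  ... | inj₂ root⊏x = from T-⊏ᵇ (subst (_⊏ decode x) (sym (decode-encode (rootPos s))) root⊏x)

  predecessors-chain : ∀ x y z → T (y ⊏ᵇ x) → T (z ⊏ᵇ x) → y ≡ z ⊎ T (y ⊏ᵇ z) ⊎ T (z ⊏ᵇ y)
  predecessors-chain x y z y⊏x z⊏x with ⊏-predecessors-chain (to T-⊏ᵇ y⊏x) (to T-⊏ᵇ z⊏x)
  ... | inj₁ y≡z         = inj₁ (decode-injective y≡z)
  ... | inj₂ (inj₁ y⊏z) = inj₂ (inj₁ (from T-⊏ᵇ y⊏z))
  ... | inj₂ (inj₂ z⊏y) = inj₂ (inj₂ (from T-⊏ᵇ z⊏y))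

  tree : Tree
  tree = record
    { size      = card s
    ; S         = _⊏ᵇ_
    ; irrefl    = λ x → ⊏-irrefl ∘ to T-⊏ᵇ
    ; trans     = λ x y z x⊏y y⊏z → from T-⊏ᵇ (⊏-trans (to T-⊏ᵇ x⊏y) (to T-⊏ᵇ y⊏z))
    ; root      = encode (rootPos s)
    ; least     = least-encode-root
    ; predChain = predecessors-chain
    }

  chain-bound : ∀ {H} → (∀ p → depth p < H) → ∀ x xs → IsChain tree (x ∷ xs) → depth (decode x) + length xs < H
  chain-bound {H} depth< x [] _ = subst (_< H) (sym (+-identityʳ _)) (depth< (decode x))
  chain-bound {H} depth< x (y ∷ ys) (x⊏y , chain) = begin-strict
    depth (decode x) + suc (length ys) ≡⟨ +-suc _ _ ⟩
    suc (depth (decode x)) + length ys ≤⟨ +-monoˡ-≤ (length ys) (⊏-depth (to T-⊏ᵇ x⊏y)) ⟩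
    depth (decode y) + length ys       <⟨ chain-bound depth< y ys chain ⟩
    H                                  ∎
    where open ≤-Reasoning

  immSucc-child : ∀ x {y} → T (immSucc tree x y) → ∃[ l ] y ≡ encode (child (decode x) l)
  immSucc-child x {y} imm with to T-∧ imm
  ... | x⊏y , ¬between with ⊏-child-or-between (to T-⊏ᵇ x⊏y)
  ...   | inj₁ (l , y≡child) = l , ≡-trans (sym (encode-decode y)) (cong encode y≡child)
  ...   | inj₂ (r , x⊏r , r⊏y) = ⊥-elim (subst T (to T-not-≡ ¬between) between)
    where
    r′≡r : decode (encode r) ≡ r
    r′≡r = decode-encode r
    between : T (any (λ z → (x ⊏ᵇ z) ∧ (z ⊏ᵇ y)) (List.allFin (card s)))
    between = any⁺ _ (lose (∈-allFin (encode r))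
      (from T-∧ (from T-⊏ᵇ (subst (decode x ⊏_) (sym r′≡r) x⊏r) , from T-⊏ᵇ (subst (_⊏ decode y) (sym r′≡r) r⊏y))))

  tree-InTr : ∀ {H b} → Fits H b s → InTr H b tree
  tree-InTr {H} {b} fits = height , branching
    where
    height : ∀ xs → IsChain tree xs → length xs ≤ H
    height []       _     = z≤n
    height (x ∷ xs) chain = ≤-trans (s≤s (m≤n+m (length xs) _)) (chain-bound (Fits-depth fits) x xs chain)
    branching : ∀ x → length (filterᵇ (immSucc tree x) (List.allFin (card s))) ≤ b
    branching x = ≤-trans
      (Unique-⊆-image⇒length≤ _ (encode ∘ child (decode x)) (filter⁺ (T? ∘ immSucc tree x) (allFin⁺ _))
         (λ y∈ → immSucc-child x (proj₂ (∈-filter⁻ (T? ∘ immSucc tree x) {xs = List.allFin (card s)} y∈))))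
      (Fits-arity fits (decode x))

module ShapeSum {A} (a : Fin A) (s : Shape) (Fs : Pos s → Frame A) (θs : ∀ p → Valuation (Fs p)) where
  open ShapeTree s
  open OrderedSum a _⊏_ Fs θs (rootPos s)

  treeVal : Valuation (sumFrame a tree (Fs ∘ decode))
  treeVal p (x , w) = θs (decode x) p w

  reindex : ∀ {p q} → p ≡ q → (w : W (Fs q)) → ∃[ w′ ] _≡_ {A = Σ (Pos s) (W ∘ Fs)} (p , w′) (q , w)
  reindex refl w = w , refl

  tree-pmorphism : PMorphism (sumFrame a tree (Fs ∘ decode)) frame treeVal val
  tree-pmorphism = record
    { map   = λ (x , w) → decode x , w
    ; val   = λ _ _ → ⇔-id _
    ; forth = λ { c (inner r) → inner r ; c (outer _ c≡a x⊏y) → outer c≡a (to T-⊏ᵇ x⊏y) }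
    ; back  = back
    }
    where
    back : ∀ c {w z} → Step c (decode (proj₁ w) , proj₂ w) z →
           ∃[ w′ ] SumR a tree (Fs ∘ decode) c w w′ × (decode (proj₁ w′) , proj₂ w′) ≡ z
    back c (inner r) = _ , inner r , refl
    back c {x , _} {q , w} (outer c≡a x⊏q) =
      let (w′ , eq) = reindex (decode-encode q) w in
      (encode q , w′) , outer x≢q c≡a (from T-⊏ᵇ (subst (decode x ⊏_) (sym (decode-encode q)) x⊏q)) , eq
      where
      x≢q : x ≢ encode q
      x≢q refl = ⊏-irrefl (subst (_⊏ q) (decode-encode q) x⊏q)

  tree-pmorphism-surjective : ∀ z → ∃[ w ] PMorphism.map tree-pmorphism w ≡ z
  tree-pmorphism-surjective (q , w) = let (w′ , eq) = reindex (decode-encode q) w in (encode q , w′) , eq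

module Completeness {A} (a : Fin A) (𝓕 : Frame A → Set) (φ : Fm A) (U : Fin A → BVec φ) (b : ℕ) where

  Γ : Condition A
  Γ = condOf φ U

  ψ : Fin (# φ) → Fm A
  ψ = lookup (subs φ)

  module PosSum (s : Shape) (Fs : Pos s → Frame A) (θs : ∀ p → Valuation (Fs p)) =
    OrderedSum a (_⊏_ {s}) Fs θs (rootPos s)

  record Built (H : ℕ) (v : BVec φ) : Set₁ where
    field
      shape    : Shape
      Fs       : Pos shape → Frame A
      θs       : ∀ p → Valuation (Fs p)
      fits     : Fits H b shape
      in𝓕      : ∀ p → 𝓕 (Fs p)
      realizes : Realizes (PosSum.frame shape Fs θs) (PosSum.val shape Fs θs) φ v U

  module Root {k} {ts : Fin k → Shape} (Fs : Pos (node k ts) → Frame A) (θs : ∀ p → Valuation (Fs p)) where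
    open PosSum (node k ts) Fs θs

    root-component : ∀ U′ u → (∀ c χ → χ ∈ subOcc φ → condOf φ U′ c χ ⇔ extend Γ a (Above Γ here) c χ) →
      Realizes (Fs here) (θs here) φ u U′ → ∀ j → T (lookup u j) ⇔ SatAt Γ here (ψ j)
    root-component U′ u U′≐Γ₀ real j = begin
      T (lookup u j)                                                   ∼⟨ real j ⟩
      (∃[ w ] Sat (Fs here) (θs here) (condOf φ U′) w (ψ j))             ∼⟨ Σ-cong-⇔ (Sat-cong-subs (Fs here) (θs here) φ U′≐Γ₀ j) ⟩
      (∃[ w ] Sat (Fs here) (θs here) (extend Γ a (Above Γ here)) w (ψ j)) ∼⟨ Σ-cong-⇔ (⇔-sym ∘ localise Γ (ψ j) here) ⟩
      SatAt Γ here (ψ j)                                               ∎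
      where open ⇔-Reasoning

    realizes-root : ∀ v → (∀ j → T (lookup v j) ⇔ Cone Γ here (ψ j)) → Realizes frame val φ v U
    realizes-root v v≐Cone j = ⇔-sym (∃Sat-Cone Γ rootPos-least (ψ j)) ⇔-∘ v≐Cone j

  leaf : ∀ {H} v → SatIn 𝓕 φ v U → Built (suc H) v
  leaf v (F , F∈𝓕 , θ , real) = record
    { shape    = node 0 noSubtrees
    ; Fs       = λ _ → F
    ; θs       = λ _ → θ
    ; fits     = z≤n , λ ()
    ; in𝓕      = λ _ → F∈𝓕
    ; realizes = realizes-root v λ j →
        ⇔-sym (Cone-maximal Γ nothing-above (ψ j))
        ⇔-∘ root-component U v (λ c χ _ → ⇔-sym (extend-maximal Γ nothing-above c χ)) real j
    }
    where
    noSubtrees : Fin 0 → Shape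
    noSubtrees ()
    open Root {ts = noSubtrees} (λ _ → F) (λ _ → θ)
    open PosSum (node 0 noSubtrees) (λ _ → F) (λ _ → θ)
    nothing-above : ∀ p → ¬ here ⊏ p
    nothing-above _ (here⊏ {i = ()})

  module Graft {H k} (F : Frame A) (θ : Valuation F) {vs : Fin k → BVec φ}
               (subtrees : ∀ l → Built (suc H) (vs l)) where
    open Built

    ts : Fin k → Shape
    ts l = shape (subtrees l)

    Fs′ : Pos (node k ts) → Frame A
    Fs′ here        = F
    Fs′ (there l q) = Fs (subtrees l) q

    θs′ : ∀ p → Valuation (Fs′ p)
    θs′ here        = θ
    θs′ (there l q) = θs (subtrees l) q

    open PosSum (node k ts) Fs′ θs′
    module Sub (l : Fin k) = PosSum (ts l) (Fs (subtrees l)) (θs (subtrees l))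

    subtree-pmorphism : ∀ l → PMorphism (Sub.frame l) frame (Sub.val l) val
    subtree-pmorphism l = record
      { map   = λ (q , w) → there l q , w
      ; val   = λ _ _ → ⇔-id _
      ; forth = λ { c (Sub.inner r) → inner r ; c (Sub.outer c≡a q⊏q′) → outer c≡a (there⊏ q⊏q′) }
      ; back  = λ { c (inner r) → _ , Sub.inner r , refl ; c (outer c≡a (there⊏ q⊏q′)) → _ , Sub.outer c≡a q⊏q′ , refl }
      }

    Above-here : ∀ χ → (∃[ l ] ∃[ z ] Sat (Sub.frame l) (Sub.val l) Γ z χ) ⇔ Above Γ here χ
    Above-here χ = mk⇔
      (λ (l , (q , w) , s) → there l q , here⊏ , w , to (Sat-pmorphism (subtree-pmorphism l) Γ χ (q , w)) s)
      (λ { (there l q , here⊏ , w , s) → l , (q , w) , from (Sat-pmorphism (subtree-pmorphism l) Γ χ (q , w)) s })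

    sumV≐Above : ∀ j → T (lookup (sumV k vs) j) ⇔ Above Γ here (ψ j)
    sumV≐Above j = begin
      T (lookup (sumV k vs) j)                              ∼⟨ T-lookup-sumV k vs j ⟩
      (∃[ l ] T (lookup (vs l) j))                          ∼⟨ Σ-cong-⇔ (λ l → realizes (subtrees l) j) ⟩
      (∃[ l ] ∃[ z ] Sat (Sub.frame l) (Sub.val l) Γ z (ψ j)) ∼⟨ Above-here (ψ j) ⟩
      Above Γ here (ψ j)                                    ∎
      where open ⇔-Reasoning

    graft-realizes : ∀ u → Realizes F θ φ u (U ⊕[ a ] sumV k vs) → Realizes frame val φ (u +V sumV k vs) U
    graft-realizes u real = realizes-root (u +V sumV k vs) λ j → begin
      T (lookup (u +V sumV k vs) j)                        ∼⟨ T-lookup-+V u (sumV k vs) j ⟩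
      (T (lookup u j) ⊎ T (lookup (sumV k vs) j))          ∼⟨ (root-component (U ⊕[ a ] sumV k vs) u (condOf-⊕ φ U a (sumV k vs) sumV≐Above) real j
                                                               ⊎-⇔ sumV≐Above j) ⟩
      (SatAt Γ here (ψ j) ⊎ Above Γ here (ψ j))           ∼⟨ ⇔-sym (Cone-split Γ here (ψ j)) ⟩
      Cone Γ here (ψ j)                                    ∎
      where
      open Root Fs′ θs′
      open ⇔-Reasoning

  build : ∀ H v → CSatSum 𝓕 a φ v U (suc H) b → Built (suc H) v
  build zero    v sat        = leaf v sat
  build (suc H) v (inj₁ sat) = leaf v sat
  build (suc H) _ (inj₂ (k , _ , k≤b , u , vs , refl , (F , F∈𝓕 , θ , real) , below)) = record
    { shape    = node k ts
    ; Fs       = Fs′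
    ; θs       = θs′
    ; fits     = k≤b , Built.fits ∘ subtrees
    ; in𝓕      = λ { here → F∈𝓕 ; (there l q) → Built.in𝓕 (subtrees l) q }
    ; realizes = graft-realizes u real
    }
    where
    subtrees : ∀ l → Built (suc H) (vs l)
    subtrees l = build H (vs l) (below l)
    open Graft F θ subtrees

  completeness : ∀ h v → 0 < h → CSatSum 𝓕 a φ v U h b → SatInSum 𝓕 a h b φ v U
  completeness (suc H) v _ sat =
    tree , tree-InTr fits , Fs ∘ decode , in𝓕 ∘ decode , treeVal ,
    from (Realizes-pmorphism tree-pmorphism tree-pmorphism-surjective φ v U) realizes
    where
    open Built (build H v sat)
    open ShapeTree shape
    open ShapeSum a shape Fs θs

theorem4p7 : ExcludedMiddle 0ℓ →
    ∀ {A : ℕ} (a : Fin A) (𝓕 : Frame A → Set)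
      (φ : Fm A) (v : BVec φ) (U : Fin A → BVec φ) (h b : ℕ) →
    0 < h → 0 < b →
    SatInSum 𝓕 a h b φ v U ⇔ CSatSum 𝓕 a φ v U h b
theorem4p7 em a 𝓕 φ v U h b 0<h _ = mk⇔
  (λ (t , t∈Tr , Fs , Fs∈𝓕 , θ , real) → Soundness.soundness em a 𝓕 φ U b t Fs Fs∈𝓕 θ h v t∈Tr real)
  (Completeness.completeness a 𝓕 φ U b h v 0<h)
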